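{- Let $D$ be a minimal counterexample to the conjecture described in the context, and $C$ its Hamilton cycle as described there. Suppose that for a vertex $x$ the edges $x^-x$ and $xx^+$ of $C$ have distinct colours. Then the edge between $x^-$ and $x^+$ is directed from $x^-$ to $x^+$, and $x^+$ monochromatically dominates $x^-$ only in the third colour (the colour different from those of $x^-x$ and $xx^+$), i.e. there is a monochromatic directed path from $x^+$ to $x^-$ in the third colour and none in the other two colours.
   Context: A 3-coloured tournament is a finite tournament each of whose edges is coloured red, blue or green. A triple of vertices spans a $T_3$ if the three edges between them form a directed cycle with three distinct colours. For distinct vertices $x,y$, $x$ monochromatically dominates $y$ in colour $c$ if there is a directed path from $x$ to $y$ all of whose edges have colour $c$. The conjecture: every 3-coloured tournament has a triple spanning a $T_3$ or a vertex monochromatically dominating every other vertex. A minimal counterexample is a 3-coloured tournament $D$ with no $T_3$ and no vertex dominating all others, such that every proper nonempty subtournament has a $T_3$ or a vertex monochromatically dominating all its other vertices within it. Such $D$ has a unique directed Hamilton cycle $C$ such that each vertex monochromatically dominates every vertex except its predecessor on $C$; $x^+$ and $x^-$ denote the successor and predecessor of $x$ on $C$. -}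

module Defs where

open import Data.Nat using (ℕ)
open import Data.Fin using (Fin)
open import Data.Bool using (Bool; true; false; T)
open import Data.Product using (Σ; ∃; _×_; _,_)
open import Data.Sum using (_⊎_)
open import Data.Empty using (⊥)
open import Function using (id)
open import Relation.Nullary using (¬_)
open import Relation.Binary.PropositionalEquality using (_≡_; _≢_)

data Colour : Set where
  red blue green : Colour

-- A 3-coloured tournament on the vertex set Fin n.
-- adj x y ≡ true means the edge between x and y is directed from x to y.
-- col x y is the colour of the edge x→y (only meaningful when adj x y ≡ true).
record Tournament3 (n : ℕ) : Set where
  field
    adj : Fin n → Fin n → Bool
    col : Fin n → Fin n → Colour
    irrefl : ∀ x → adj x x ≡ false
    tourn  : ∀ x y → x ≢ y → adj x y ≢ adj y x

module _ {n : ℕ} (D : Tournament3 n) where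
  open Tournament3 D

  Arc : Fin n → Fin n → Set
  Arc x y = adj x y ≡ true

  Subset : Set
  Subset = Fin n → Bool

  full : Subset
  full _ = true

  -- Monochromatic directed walk of colour c from x to y, with all vertices in S.
  -- (A monochromatic walk exists iff a monochromatic directed path exists.)
  data MonoPath (S : Subset) (c : Colour) : Fin n → Fin n → Set where
    edge : ∀ {x y} → T (S x) → T (S y) → Arc x y → col x y ≡ c → MonoPath S c x y
    step : ∀ {x y z} → T (S x) → Arc x y → col x y ≡ c → MonoPath S c y z → MonoPath S c x z

  Dominates : Subset → Fin n → Fin n → Set
  Dominates S x y = x ≢ y × Σ Colour (λ c → MonoPath S c x y)

  HasT3 : Subset → Set
  HasT3 S = Σ (Fin n) λ x → Σ (Fin n) λ y → Σ (Fin n) λ z →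
    T (S x) × T (S y) × T (S z) ×
    Arc x y × Arc y z × Arc z x ×
    col x y ≢ col y z × col y z ≢ col z x × col z x ≢ col x y

  HasKing : Subset → Set
  HasKing S = Σ (Fin n) λ x → T (S x) × (∀ y → T (S y) → y ≢ x → Dominates S x y)

  Good : Subset → Set
  Good S = HasT3 S ⊎ HasKing S

  ProperNonempty : Subset → Set
  ProperNonempty S = (Σ (Fin n) λ x → T (S x)) × (Σ (Fin n) λ x → ¬ T (S x))

  MinimalCounterexample : Set
  MinimalCounterexample = ¬ Good full × (∀ S → ProperNonempty S → Good S)

  iter : (Fin n → Fin n) → ℕ → Fin n → Fin n
  iter f ℕ.zero x = x
  iter f (ℕ.suc k) x = f (iter f k x)

  record HamCycle : Set where
    field
      succ pred : Fin n → Fin n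
      succ-pred : ∀ x → succ (pred x) ≡ x
      pred-succ : ∀ x → pred (succ x) ≡ x
      arcs : ∀ x → Arc x (succ x)
      oneOrbit : ∀ x y → Σ ℕ λ k → iter succ k x ≡ y

  DominatingCycle : HamCycle → Set
  DominatingCycle C = ∀ x y → y ≢ x → y ≢ HamCycle.pred C x → Dominates full x y

module Submission where

-- In a 3-coloured tournament without a monochromatic king
-- (a vertex dominating all others), if C is a Hamilton cycle along which each
-- vertex dominates everyone except its predecessor, then NO vertex y has a
-- monochromatic path to its predecessor y⁻: otherwise y would be a king.
-- Everything else follows from this single fact by extending paths by an arc of
-- C.  Write x⁻ → x → x⁺ with distinct colours a, b.  A path x⁺ ⇝ x⁻ of colour a
-- extends by x⁻x to x⁺ ⇝ x = (x⁺)⁻; one of colour b extends by xx⁺ in front to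
-- x ⇝ x⁻.  Both are forbidden.  But x⁺ does dominate x⁻ (as x⁻ ≠ (x⁺)⁻), so its
-- path has the third colour, which is unique since there are only three
-- colours.  Finally, if the arc between x⁻ and x⁺ pointed back to x⁻, the same
-- extension argument shows that its colour differs from a and from b, so x⁻x⁺x
-- would be a T₃.

open import Defs
open import Data.Nat using (ℕ)
open import Data.Fin using (Fin) renaming (_≟_ to _≟F_)
open import Data.Bool using (true; false; T)
open import Data.Unit using (tt)
open import Data.Product using (_×_; _,_; proj₁)
open import Data.Sum using (_⊎_; inj₁; inj₂)
open import Data.Empty using (⊥-elim)
open import Relation.Nullary using (¬_; yes; no)
open import Relation.Binary.PropositionalEquality
  using (_≡_; _≢_; refl; sym; trans; subst)

avoid-red-blue : ∀ {c} → c ≢ red → c ≢ blue → c ≡ green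
avoid-red-blue {red}   ≢r _  = ⊥-elim (≢r refl)
avoid-red-blue {blue}  _  ≢b = ⊥-elim (≢b refl)
avoid-red-blue {green} _  _  = refl

avoid-red-green : ∀ {c} → c ≢ red → c ≢ green → c ≡ blue
avoid-red-green {red}   ≢r _  = ⊥-elim (≢r refl)
avoid-red-green {blue}  _  _  = refl
avoid-red-green {green} _  ≢g = ⊥-elim (≢g refl)

avoid-blue-green : ∀ {c} → c ≢ blue → c ≢ green → c ≡ red
avoid-blue-green {red}   _  _  = refl
avoid-blue-green {blue}  ≢b _  = ⊥-elim (≢b refl)
avoid-blue-green {green} _  ≢g = ⊥-elim (≢g refl)

third-colour-unique : ∀ {a b c d : Colour} → a ≢ b →
  c ≢ a → c ≢ b → d ≢ a → d ≢ b → c ≡ d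
third-colour-unique {red}   {red}   a≢b _ _ _ _ = ⊥-elim (a≢b refl)
third-colour-unique {blue}  {blue}  a≢b _ _ _ _ = ⊥-elim (a≢b refl)
third-colour-unique {green} {green} a≢b _ _ _ _ = ⊥-elim (a≢b refl)
third-colour-unique {red}   {blue}  _ ca cb da db =
  trans (avoid-red-blue ca cb) (sym (avoid-red-blue da db))
third-colour-unique {blue}  {red}   _ ca cb da db =
  trans (avoid-red-blue cb ca) (sym (avoid-red-blue db da))
third-colour-unique {red}   {green} _ ca cb da db =
  trans (avoid-red-green ca cb) (sym (avoid-red-green da db))
third-colour-unique {green} {red}   _ ca cb da db =
  trans (avoid-red-green cb ca) (sym (avoid-red-green db da))
third-colour-unique {blue}  {green} _ ca cb da db =
  trans (avoid-blue-green ca cb) (sym (avoid-blue-green da db))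
third-colour-unique {green} {blue}  _ ca cb da db =
  trans (avoid-blue-green cb ca) (sym (avoid-blue-green db da))

module TournamentFacts {n : ℕ} (D : Tournament3 n) where
  open Tournament3 D

  arc-irreflexive : ∀ {u} → ¬ Arc D u u
  arc-irreflexive {u} uu with trans (sym uu) (irrefl u)
  ... | ()

  arc-asymmetric : ∀ {u v} → Arc D u v → ¬ Arc D v u
  arc-asymmetric {u} {v} uv vu with u ≟F v
  ... | yes refl = arc-irreflexive uv
  ... | no u≢v = tourn u v u≢v (trans uv (sym vu))

  arc-or-reverse : ∀ u v → u ≢ v → Arc D u v ⊎ Arc D v u
  arc-or-reverse u v u≢v with adj u v in uv | adj v u in vu
  ... | true  | _     = inj₁ refl
  ... | false | true  = inj₂ refl
  ... | false | false = ⊥-elim (tourn u v u≢v (trans uv (sym vu)))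

  append-arc : ∀ {S c u v w} → MonoPath D S c u v → T (S w) →
    Arc D v w → col v w ≡ c → MonoPath D S c u w
  append-arc (edge su sv a e) sw vw e′ = step su a e (edge sv sw vw e′)
  append-arc (step su a e p)  sw vw e′ = step su a e (append-arc p sw vw e′)

module DominatingCycleFacts {n : ℕ} (D : Tournament3 n) (C : HamCycle D)
  (dominating : DominatingCycle D C) (noKing : ¬ HasKing D (full D)) where
  open Tournament3 D
  open HamCycle C
  open TournamentFacts D

  Path : Colour → Fin n → Fin n → Set
  Path = MonoPath D (full D)

  -- The key fact: no vertex reaches its predecessor monochromatically, since
  -- such a vertex would dominate every other vertex.
  no-path-to-pred : ∀ {c} y → ¬ Path c y (pred y)
  no-path-to-pred {c} y path = noKing (y , tt , dominatesAll)
    where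
    dominatesAll : ∀ z → T true → z ≢ y → Dominates D (full D) y z
    dominatesAll z _ z≢y with z ≟F pred y
    ... | yes refl = (λ y≡z → z≢y (sym y≡z)) , c , path
    ... | no z≢pred = dominating y z z≢y z≢pred

  arc-into : ∀ y → Arc D (pred y) y
  arc-into y = subst (Arc D (pred y)) (succ-pred y) (arcs (pred y))

  pred≢succ : ∀ x → pred x ≢ succ x
  pred≢succ x p≡s =
    arc-asymmetric (arc-into x) (subst (Arc D x) (sym p≡s) (arcs x))

  -- The pair (x⁺, x⁻) is not an exceptional pair of the dominating cycle.
  succ-dominates-pred : ∀ x → Dominates D (full D) (succ x) (pred x)
  succ-dominates-pred x = dominating (succ x) (pred x) (pred≢succ x) pred≢x
    where
    pred≢x : pred x ≢ pred (succ x)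
    pred≢x p≡x = arc-irreflexive
      (subst (λ v → Arc D v x) (trans p≡x (pred-succ x)) (arc-into x))

  -- No path x⁺ ⇝ x⁻ in the colour of x⁻x: appending x⁻x reaches x = (x⁺)⁻.
  no-path-in-colour-before : ∀ {c} x → c ≡ col (pred x) x →
    ¬ Path c (succ x) (pred x)
  no-path-in-colour-before x c≡a path = no-path-to-pred (succ x)
    (subst (Path _ (succ x)) (sym (pred-succ x))
      (append-arc path tt (arc-into x) (sym c≡a)))

  -- No path x⁺ ⇝ x⁻ in the colour of xx⁺: prepending xx⁺ gives x ⇝ x⁻.
  no-path-in-colour-after : ∀ {c} x → c ≡ col x (succ x) →
    ¬ Path c (succ x) (pred x)
  no-path-in-colour-after x c≡b path =
    no-path-to-pred x (step tt (arcs x) (sym c≡b) path)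

module MinimalCounterexampleFacts {n : ℕ} (D : Tournament3 n) (MC : MinimalCounterexample D)
  (C : HamCycle D) (dominating : DominatingCycle D C) where
  open Tournament3 D
  open HamCycle C
  open TournamentFacts D
  open DominatingCycleFacts D C dominating (λ king → proj₁ MC (inj₂ king))

  -- If x⁻x and xx⁺ differ in colour, the arc between x⁻ and x⁺ is x⁻x⁺:
  -- a reverse arc x⁺x⁻ would close a T₃ x⁻ → x → x⁺ → x⁻.
  pred-to-succ : ∀ x → col (pred x) x ≢ col x (succ x) →
    Arc D (pred x) (succ x)
  pred-to-succ x a≢b with arc-or-reverse (pred x) (succ x) (pred≢succ x)
  ... | inj₁ forward = forward
  ... | inj₂ back = ⊥-elim (proj₁ MC (inj₁ triangle))
    where
    backPath : Path (col (succ x) (pred x)) (succ x) (pred x)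
    backPath = edge tt tt back refl

    triangle : HasT3 D (full D)
    triangle = pred x , x , succ x , tt , tt , tt ,
      arc-into x , arcs x , back , a≢b ,
      (λ b≡c → no-path-in-colour-after x (sym b≡c) backPath) ,
      (λ c≡a → no-path-in-colour-before x c≡a backPath)

lemma2p7 : {n : ℕ} (D : Tournament3 n) → MinimalCounterexample D →
    (C : HamCycle D) → DominatingCycle D C →
    (x : Fin n) →
    Tournament3.col D (HamCycle.pred C x) x ≢ Tournament3.col D x (HamCycle.succ C x) →
    Arc D (HamCycle.pred C x) (HamCycle.succ C x) ×
    (∀ c → c ≢ Tournament3.col D (HamCycle.pred C x) x → c ≢ Tournament3.col D x (HamCycle.succ C x) →
      MonoPath D (full D) c (HamCycle.succ C x) (HamCycle.pred C x)) ×
    (∀ c → (c ≡ Tournament3.col D (HamCycle.pred C x) x ⊎ c ≡ Tournament3.col D x (HamCycle.succ C x)) →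
      ¬ MonoPath D (full D) c (HamCycle.succ C x) (HamCycle.pred C x))
lemma2p7 D MC C dominating x a≢b =
  MinimalCounterexampleFacts.pred-to-succ D MC C dominating x a≢b , thirdColourPath , noOtherPath
  where
  open Tournament3 D
  open HamCycle C
  open DominatingCycleFacts D C dominating (λ king → proj₁ MC (inj₂ king))

  noOtherPath : ∀ c → (c ≡ col (pred x) x ⊎ c ≡ col x (succ x)) →
    ¬ Path c (succ x) (pred x)
  noOtherPath c (inj₁ c≡a) = no-path-in-colour-before x c≡a
  noOtherPath c (inj₂ c≡b) = no-path-in-colour-after x c≡b

  -- x⁺ dominates x⁻ in some colour c′; it is neither a nor b, so it is c.
  thirdColourPath : ∀ c → c ≢ col (pred x) x → c ≢ col x (succ x) →
    Path c (succ x) (pred x)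
  thirdColourPath c c≢a c≢b with succ-dominates-pred x
  ... | _ , c′ , path = subst (λ d → Path d (succ x) (pred x))
    (third-colour-unique a≢b
      (λ c′≡a → noOtherPath c′ (inj₁ c′≡a) path)
      (λ c′≡b → noOtherPath c′ (inj₂ c′≡b) path) c≢a c≢b)
    path
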